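{- Let $\langle X,+\rangle$ be a Polish abelian group and $\Gamma$ a countable union of slim linear hypergraphs of arity three on $X$ (with fixed generating homomorphisms). Let $\langle I,\le,A_i,c_i,d_i\colon i\in I\rangle$ be a coherent sequence of colorings, and let $e$ be its amalgamation. Then $e$ is a $\Gamma$-coloring on $\bigcup_{i\in I}A_i$, i.e., no hyperedge of $\Gamma$ contained in $\bigcup_{i\in I}A_i$ is $e$-monochromatic.
   Context: Slim linear hypergraph generated by Borel homomorphisms $g_0,g_1,g_2\colon X\to X$: each of $g_0,g_1,g_2,g_0+g_1,g_1+g_2,g_0+g_2$ is injective, and the hypergraph consists of all triples of pairwise distinct points which under a suitable enumeration satisfy $g_0(x_0)+g_1(x_1)+g_2(x_2)=0$. Writing $\Gamma=\bigcup_i\Gamma_i$ with $\Gamma_i$ generated by $g^i_0,g^i_1,g^i_2$, a set $A\subset X$ is $\Gamma$-closed if it is a subgroup closed under each $g^i_j$ and its (partial) inverse and under the inverses of $g^i_j+g^i_k$ for distinct $j,k$. For $B\subset X$ the remainder graph $\Gamma_B$ is the graph on $X\setminus B$ connecting distinct $x,y$ if $\{x,y,z\}\in\Gamma$ for some $z\in B$. $\mathrm{HF}$ denotes the set of hereditarily finite sets. A coherent sequence of colorings is a tuple $\langle I,\le,A_i,c_i,d_i\colon i\in I\rangle$ where: $\langle I,\le\rangle$ is a linear order; $\langle A_i\colon i\in I\rangle$ is an inclusion-increasing sequence of $\Gamma$-closed subsets of $X$; for every $x\in\bigcup_iA_i$ there is a least $i$ with $x\in A_i$; $c_i\colon A_i\to\mathrm{HF}$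 is a $\Gamma$-coloring (no hyperedge inside $A_i$ monochromatic); if $i$ is the least element of $I$ then $d_i=0$, and otherwise $d_i\colon A_i\setminus\bigcup_{j<i}A_j\to\mathrm{HF}$ is a coloring of the remainder graph $\Gamma_{\bigcup_{j<i}A_j}$ (restricted to its domain). The amalgamation is the function $e$ on $\bigcup_iA_i$ defined by: for $x$, let $i$ be least with $x\in A_i$; if $i$ is the least element of $I$ let $e(x)=c_i(x)$, otherwise $e(x)=\langle c_i(x),d_i(x)\rangle$. -}

module Defs where

open import Data.Nat as ℕ using (ℕ; _^_)
open import Data.Bool using (if_then_else_)
open import Data.Fin using (Fin; zero; suc)
open import Data.Fin.Permutation using (Permutation′; _⟨$⟩ʳ_)
open import Data.Product using (Σ; ∃; _×_; _,_)
open import Relation.Nullary using (¬_; does)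
open import Relation.Binary.PropositionalEquality using (_≡_; _≢_)
open import Relation.Binary.Structures using (IsTotalOrder)
open import Algebra.Structures using (IsAbelianGroup)
open import Function.Definitions using (Injective)

-- Hereditarily finite sets, via the Ackermann coding HF ≅ ℕ
-- (x ∈ y iff the x-th binary digit of y is 1).  The empty set is 0.

HF : Set
HF = ℕ

∅HF : HF
∅HF = 0

-- Kuratowski pair ⟨a,b⟩ = {{a},{a,b}} in the Ackermann coding:
-- {a} = 2^a, {a,b} = 2^a + 2^b (a ≠ b), ⟨a,a⟩ = {{a}}.
pairHF : HF → HF → HF
pairHF a b =
  if does (a ℕ.≟ b)
  then 2 ^ (2 ^ a)
  else 2 ^ (2 ^ a) ℕ.+ 2 ^ (2 ^ a ℕ.+ 2 ^ b)

record AbGroup : Set₁ where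
  infixl 6 _+_
  field
    Carrier : Set
    _+_ : Carrier → Carrier → Carrier
    0# : Carrier
    -_ : Carrier → Carrier
    isAbelianGroup : IsAbelianGroup _≡_ _+_ 0# -_

module _ (G : AbGroup) where
  open AbGroup G renaming (Carrier to X)

  IsHom : (X → X) → Set
  IsHom g = ∀ x y → g (x + y) ≡ g x + g y

  record SlimGen : Set where
    field
      g : Fin 3 → X → X
      hom : ∀ j → IsHom (g j)
      inj : ∀ j → Injective _≡_ _≡_ (g j)
      injSum : ∀ j k → j ≢ k → Injective _≡_ _≡_ (λ x → g j x + g k x)

  Triple : Set
  Triple = Fin 3 → X

  tri : X → X → X → Triple
  tri x y z zero = x
  tri x y z (suc zero) = y
  tri x y z (suc (suc zero)) = z

  Distinct : Triple → Set
  Distinct v = ∀ j k → j ≢ k → v j ≢ v k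

  EdgeOf : SlimGen → Triple → Set
  EdgeOf S v = Distinct v × ∃ λ (σ : Permutation′ 3) →
      g zero (v (σ ⟨$⟩ʳ zero))
    + g (suc zero) (v (σ ⟨$⟩ʳ suc zero))
    + g (suc (suc zero)) (v (σ ⟨$⟩ʳ suc (suc zero))) ≡ 0#
    where open SlimGen S

  -- Γ = ⋃_{k ∈ K} Γ_k, K countable (injects into ℕ)
  record Hyp : Set₁ where
    field
      K : Set
      code : K → ℕ
      code-inj : Injective _≡_ _≡_ code
      gen : K → SlimGen

  module _ (Γ : Hyp) where
    open Hyp Γ

    InΓ : Triple → Set
    InΓ v = ∃ λ k → EdgeOf (gen k) v

    Subset : Set₁
    Subset = X → Set

    record Closed (A : Subset) : Set where
      field
        zero∈ : A 0#
        +∈ : ∀ x y → A x → A y → A (x + y)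
        -∈ : ∀ x → A x → A (- x)
        g∈ : ∀ k j x → A x → A (SlimGen.g (gen k) j x)
        g⁻¹∈ : ∀ k j x → A (SlimGen.g (gen k) j x) → A x
        sum⁻¹∈ : ∀ k j l → j ≢ l → ∀ x →
                 A (SlimGen.g (gen k) j x + SlimGen.g (gen k) l x) → A x

    RemAdj : Subset → X → X → Set
    RemAdj B x y = ¬ B x × ¬ B y × x ≢ y × ∃ λ z → B z × InΓ (tri x y z)

    Mono : (Fin 3 → HF) → Set
    Mono w = w zero ≡ w (suc zero) × w (suc zero) ≡ w (suc (suc zero))

    -- coherent sequence of colorings; c i, d i are given as total functions
    -- X → HF, only their values on A i (resp. on the new part of A i) matter
    record Coherent : Set₁ where
      field
        I : Set
        _≤_ : I → I → Set
        isTotalOrder : IsTotalOrder _≡_ _≤_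
        A : I → Subset
        A-closed : ∀ i → Closed (A i)
        A-mono : ∀ i j → i ≤ j → ∀ x → A i x → A j x
        least : ∀ x → (∃ λ i → A i x) →
                ∃ λ i → A i x × (∀ j → A j x → i ≤ j)
        c d : I → X → HF

      _<_ : I → I → Set
      j < i = j ≤ i × j ≢ i

      IsLeast : I → Set
      IsLeast i = ∀ j → i ≤ j

      Below : I → Subset
      Below i x = ∃ λ j → j < i × A j x

      New : I → Subset
      New i x = A i x × ¬ Below i x

      field
        c-col : ∀ i v → InΓ v → (∀ m → A i (v m)) → ¬ Mono (λ m → c i (v m))
        d-least : ∀ i → IsLeast i → ∀ x → New i x → d i x ≡ ∅HF
        d-col : ∀ i → ¬ IsLeast i → ∀ x y → New i x → New i y →
                RemAdj (Below i) x y → d i x ≢ d i y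

      -- graph of the amalgamation e : ⋃ A i → HF
      Amalg : X → HF → Set
      Amalg x w = ∃ λ i → A i x × (∀ j → A j x → i ≤ j)
                  × (IsLeast i → w ≡ c i x)
                  × (¬ IsLeast i → w ≡ pairHF (c i x) (d i x))

-- Let i be the largest of the stages at which the three vertices of a hyperedge
-- first appear.  If all three appear at stage i, their colours c_i agree (pairing
-- on HF is injective), contradicting that c_i is a Γ-colouring.  If exactly two
-- appear at stage i, they are adjacent in the remainder graph through the third
-- vertex, so d_i separates them.  If only one does, the other two lie in a
-- Γ-closed A_j with j < i, and closedness puts the third vertex into A_j as well.

module Submission where

open import Defs
open import Data.Fin using (Fin)
open import Relation.Nullary using (¬_; yes; no)

open import Level using (0ℓ)
open import Data.Fin.Patterns using (0F; 1F; 2F)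
open import Data.Fin.Permutation
  using (Permutation′; _⟨$⟩ʳ_; _⟨$⟩ˡ_; inverseˡ; inverseʳ; id; flip; transpose; _∘ₚ_)
open import Data.Product as Product using (∃; _×_; _,_; proj₁; proj₂)
open import Data.Sum using (_⊎_; inj₁; inj₂)
open import Data.Empty using (⊥; ⊥-elim)
open import Function.Bundles using (Injection)
open import Function.Properties.Inverse using (↔⇒↣)
open import Relation.Nullary.Decidable using (¬¬-excluded-middle)
open import Relation.Nullary.Negation using (contradiction)
open import Relation.Binary using (Rel; Total)
open import Relation.Binary.PropositionalEquality
open import Relation.Binary.Structures using (IsTotalOrder)
open import Algebra.Bundles using (AbelianGroup)
import Algebra.Properties.AbelianGroup as AbelianGroupProperties

module PairHF where
  open import Data.Nat using (suc; pred; _+_; _*_; _^_; _≡ᵇ_; ≢-nonZero⁻¹)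
  open import Data.Nat.Properties
    using (≡ᵇ⇒≡; ≡⇒≡ᵇ; suc-injective; *-identityˡ; *-identityʳ; *-assoc; *-suc;
           *-cancelˡ-≡; even≢odd; ^-distribˡ-+-*; m^n≢0; suc-pred)
  open import Data.Nat.Logarithm using (⌊log₂_⌋; ⌊log₂[2^n]⌋≡n)
  open import Data.Bool using (true; false; T)

  2^-injective : ∀ {m n} → 2 ^ m ≡ 2 ^ n → m ≡ n
  2^-injective {m} {n} eq =
    trans (sym (⌊log₂[2^n]⌋≡n m)) (trans (cong ⌊log₂_⌋ eq) (⌊log₂[2^n]⌋≡n n))

  2^n≢0 : ∀ n → 2 ^ n ≢ 0
  2^n≢0 n = ≢-nonZero⁻¹ (2 ^ n) {{m^n≢0 2 n}}

  2^*odd-injective : ∀ m n x y → 2 ^ m * suc (2 * x) ≡ 2 ^ n * suc (2 * y) → m ≡ n × x ≡ y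
  2^*odd-injective 0 0 x y eq
    rewrite *-identityˡ (suc (2 * x)) | *-identityˡ (suc (2 * y)) =
    refl , *-cancelˡ-≡ x y 2 (suc-injective eq)
  2^*odd-injective 0 (suc n) x y eq
    rewrite *-identityˡ (suc (2 * x)) | *-assoc 2 (2 ^ n) (suc (2 * y)) =
    contradiction (sym eq) (even≢odd (2 ^ n * suc (2 * y)) x)
  2^*odd-injective (suc m) 0 x y eq
    rewrite *-identityˡ (suc (2 * y)) | *-assoc 2 (2 ^ m) (suc (2 * x)) =
    contradiction eq (even≢odd (2 ^ m * suc (2 * x)) y)
  2^*odd-injective (suc m) (suc n) x y eq
    rewrite *-assoc 2 (2 ^ m) (suc (2 * x)) | *-assoc 2 (2 ^ n) (suc (2 * y)) =
    Product.map₁ (cong suc) (2^*odd-injective m n x y (*-cancelˡ-≡ _ _ 2 eq))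

  2^2^n≡2*2^pred2^n : ∀ n → 2 ^ 2 ^ n ≡ 2 * 2 ^ pred (2 ^ n)
  2^2^n≡2*2^pred2^n n = cong (2 ^_) (sym (suc-pred (2 ^ n) {{m^n≢0 2 n}}))

  pairHF-2-adic : ∀ a b →
      a ≡ b × pairHF a b ≡ 2 ^ 2 ^ a * suc (2 * 0)
    ⊎ a ≢ b × pairHF a b ≡ 2 ^ 2 ^ a * suc (2 * 2 ^ pred (2 ^ b))
  pairHF-2-adic a b with a ≡ᵇ b in a≡ᵇb
  ... | true  = inj₁ (≡ᵇ⇒≡ a b (subst T (sym a≡ᵇb) _) , sym (*-identityʳ _))
  ... | false = inj₂ ((λ a≡b → subst T a≡ᵇb (≡⇒≡ᵇ a b a≡b)) , (begin
    2 ^ 2 ^ a + 2 ^ (2 ^ a + 2 ^ b)         ≡⟨ cong (2 ^ 2 ^ a +_) (^-distribˡ-+-* 2 (2 ^ a) (2 ^ b)) ⟩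
    2 ^ 2 ^ a + 2 ^ 2 ^ a * 2 ^ 2 ^ b       ≡⟨ cong (λ t → 2 ^ 2 ^ a + 2 ^ 2 ^ a * t) (2^2^n≡2*2^pred2^n b) ⟩
    2 ^ 2 ^ a + 2 ^ 2 ^ a * (2 * 2 ^ pred (2 ^ b)) ≡⟨ *-suc (2 ^ 2 ^ a) _ ⟨
    2 ^ 2 ^ a * suc (2 * 2 ^ pred (2 ^ b))  ∎))
    where open ≡-Reasoning

  pairHF-injective : ∀ {a b a′ b′} → pairHF a b ≡ pairHF a′ b′ → a ≡ a′ × b ≡ b′
  pairHF-injective {a} {b} {a′} {b′} eq with pairHF-2-adic a b | pairHF-2-adic a′ b′
  ... | inj₁ (refl , p) | inj₁ (refl , p′) =
    let a≡a′ = 2^-injective (proj₁ (2^*odd-injective (2 ^ a) (2 ^ a′) 0 0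
                                                      (trans (sym p) (trans eq p′))))
    in a≡a′ , a≡a′
  ... | inj₁ (_ , p) | inj₂ (_ , p′) =
    contradiction (sym (proj₂ (2^*odd-injective (2 ^ a) (2 ^ a′) 0 (2 ^ pred (2 ^ b′))
      (trans (sym p) (trans eq p′))))) (2^n≢0 (pred (2 ^ b′)))
  ... | inj₂ (_ , p) | inj₁ (_ , p′) =
    contradiction (proj₂ (2^*odd-injective (2 ^ a) (2 ^ a′) (2 ^ pred (2 ^ b)) 0
      (trans (sym p) (trans eq p′)))) (2^n≢0 (pred (2 ^ b)))
  ... | inj₂ (_ , p) | inj₂ (_ , p′) =
    let 2^a≡2^a′ , h≡h′ = 2^*odd-injective (2 ^ a) (2 ^ a′) (2 ^ pred (2 ^ b)) (2 ^ pred (2 ^ b′))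
                            (trans (sym p) (trans eq p′))
    in 2^-injective 2^a≡2^a′ ,
       2^-injective (2^-injective (trans (2^2^n≡2*2^pred2^n b)
         (trans (cong (2 *_) h≡h′) (sym (2^2^n≡2*2^pred2^n b′)))))

open PairHF using (pairHF-injective)

module _ {a ℓ} {A : Set a} {_≤_ : Rel A ℓ} (total : Total _≤_) where

  sort₃ : (f : Fin 3 → A) → ∃ λ (π : Permutation′ 3) →
          f (π ⟨$⟩ʳ 2F) ≤ f (π ⟨$⟩ʳ 1F) × f (π ⟨$⟩ʳ 1F) ≤ f (π ⟨$⟩ʳ 0F)
  sort₃ f with total (f 0F) (f 1F)
  ... | inj₁ f₀≤f₁ with total (f 1F) (f 2F)
  ...   | inj₁ f₁≤f₂ = transpose 0F 2F , f₀≤f₁ , f₁≤f₂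
  ...   | inj₂ f₂≤f₁ with total (f 0F) (f 2F)
  ...     | inj₁ f₀≤f₂ = transpose 1F 2F ∘ₚ transpose 0F 1F , f₀≤f₂ , f₂≤f₁
  ...     | inj₂ f₂≤f₀ = transpose 0F 1F , f₂≤f₀ , f₀≤f₁
  sort₃ f | inj₂ f₁≤f₀ with total (f 0F) (f 2F)
  ...   | inj₁ f₀≤f₂ = transpose 0F 1F ∘ₚ transpose 1F 2F , f₁≤f₀ , f₀≤f₂
  ...   | inj₂ f₂≤f₀ with total (f 1F) (f 2F)
  ...     | inj₁ f₁≤f₂ = transpose 1F 2F , f₁≤f₂ , f₂≤f₀
  ...     | inj₂ f₂≤f₁ = id , f₂≤f₁ , f₁≤f₀

module Hyperedges (G : AbGroup) (Γ : Hyp G) where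
  open AbGroup G renaming (Carrier to X)
  open Hyp Γ

  private
    abelianGroup : AbelianGroup 0ℓ 0ℓ
    abelianGroup = record { isAbelianGroup = isAbelianGroup }
  open AbelianGroup abelianGroup using (assoc; comm)
  open AbelianGroupProperties abelianGroup using (inverseˡ-unique)

  InΓ-reindex : ∀ {u v} (π : Permutation′ 3) → (∀ m → u m ≡ v (π ⟨$⟩ʳ m)) →
                InΓ G Γ v → InΓ G Γ u
  InΓ-reindex {u} {v} π u≗v∘π (k , distinct , σ , sum≡0) =
    k , distinct′ , σ ∘ₚ flip π , trans sum-reindexed sum≡0
    where
      open SlimGen (gen k)
      u∘π⁻¹∘σ≗v∘σ : ∀ j → u (π ⟨$⟩ˡ (σ ⟨$⟩ʳ j)) ≡ v (σ ⟨$⟩ʳ j)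
      u∘π⁻¹∘σ≗v∘σ j = trans (u≗v∘π _) (cong v (inverseʳ π))
      sum-reindexed : g 0F (u (π ⟨$⟩ˡ (σ ⟨$⟩ʳ 0F))) + g 1F (u (π ⟨$⟩ˡ (σ ⟨$⟩ʳ 1F)))
                        + g 2F (u (π ⟨$⟩ˡ (σ ⟨$⟩ʳ 2F)))
                    ≡ g 0F (v (σ ⟨$⟩ʳ 0F)) + g 1F (v (σ ⟨$⟩ʳ 1F)) + g 2F (v (σ ⟨$⟩ʳ 2F))
      sum-reindexed = cong₂ _+_ (cong₂ _+_ (cong (g 0F) (u∘π⁻¹∘σ≗v∘σ 0F))
                                           (cong (g 1F) (u∘π⁻¹∘σ≗v∘σ 1F)))
                                (cong (g 2F) (u∘π⁻¹∘σ≗v∘σ 2F))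
      distinct′ : Distinct G u
      distinct′ j l j≢l uj≡ul =
        distinct (π ⟨$⟩ʳ j) (π ⟨$⟩ʳ l) (λ πj≡πl → j≢l (Injection.injective (↔⇒↣ π) πj≡πl))
                 (trans (sym (u≗v∘π j)) (trans uj≡ul (u≗v∘π l)))

  module _ {B : Subset G Γ} (closed : Closed G Γ B) where
    open Closed closed

    ∈-of-sum≡0 : ∀ {x y} → x + y ≡ 0# → B y → B x
    ∈-of-sum≡0 {x} {y} x+y≡0 y∈B = subst B (sym (inverseˡ-unique x y x+y≡0)) (-∈ y y∈B)

    ∈-of-sum₃≡0 : (a : Fin 3 → X) → a 0F + a 1F + a 2F ≡ 0# →
                  ∀ t → (∀ s → s ≢ t → B (a s)) → B (a t)
    ∈-of-sum₃≡0 a sum≡0 0F others =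
      ∈-of-sum≡0 (trans (sym (assoc _ _ _)) sum≡0)
        (+∈ _ _ (others 1F λ ()) (others 2F λ ()))
    ∈-of-sum₃≡0 a sum≡0 1F others =
      ∈-of-sum≡0 (trans (sym (assoc _ _ _)) (trans (cong (_+ a 2F) (comm _ _)) sum≡0))
        (+∈ _ _ (others 0F λ ()) (others 2F λ ()))
    ∈-of-sum₃≡0 a sum≡0 2F others =
      ∈-of-sum≡0 (trans (comm _ _) sum≡0)
        (+∈ _ _ (others 0F λ ()) (others 1F λ ()))

    -- v p enters the hyperedge equation through its (σ⁻¹ p)-th summand.
    edge-closed : ∀ {v} → InΓ G Γ v → ∀ p → (∀ s → s ≢ p → B (v s)) → B (v p)
    edge-closed {v} (k , _ , σ , sum≡0) p others =
      subst (λ q → B (v q)) (inverseʳ σ)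
        (g⁻¹∈ k t _ (∈-of-sum₃≡0 (λ s → g s (v (σ ⟨$⟩ʳ s))) sum≡0 t other-summands))
      where
        open SlimGen (gen k)
        t = σ ⟨$⟩ˡ p
        other-summands : ∀ s → s ≢ t → B (g s (v (σ ⟨$⟩ʳ s)))
        other-summands s s≢t = g∈ k s _ (others (σ ⟨$⟩ʳ s) λ σs≡p →
          s≢t (trans (sym (inverseˡ σ)) (cong (σ ⟨$⟩ˡ_) σs≡p)))

module Amalgamation (G : AbGroup) (Γ : Hyp G) (S : Coherent G Γ) where
  open AbGroup G using () renaming (Carrier to X)
  open Coherent S
  open IsTotalOrder isTotalOrder using (antisym)
  open Hyperedges G Γ

  IsLeastIndex : X → I → Set
  IsLeastIndex x i = A i x × (∀ j → A j x → i ≤ j)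

  ColourAt : I → X → HF → Set
  ColourAt i x a = (IsLeast i → a ≡ c i x) × (¬ IsLeast i → a ≡ pairHF (c i x) (d i x))

  AmalgAt : I → X → HF → Set
  AmalgAt i x a = IsLeastIndex x i × ColourAt i x a

  index : ∀ {x a} → Amalg x a → I
  index = proj₁

  amalgAt-index : ∀ {x a} (p : Amalg x a) → AmalgAt (index p) x a
  amalgAt-index (_ , x∈ , minimal , colour) = (x∈ , minimal) , colour

  Mono⇒≡w₀ : ∀ {w} → Mono G Γ w → ∀ m → w m ≡ w 0F
  Mono⇒≡w₀ _ 0F = refl
  Mono⇒≡w₀ (w₀≡w₁ , _) 1F = sym w₀≡w₁
  Mono⇒≡w₀ (w₀≡w₁ , w₁≡w₂) 2F = sym (trans w₀≡w₁ w₁≡w₂)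

  leastIndex⇒New : ∀ {x i} → IsLeastIndex x i → New i x
  leastIndex⇒New (x∈ , minimal) =
    x∈ , λ (j , (j≤i , j≢i) , x∈Aj) → j≢i (antisym j≤i (minimal j x∈Aj))

  <⇒¬IsLeast : ∀ {j i} → j < i → ¬ IsLeast i
  <⇒¬IsLeast (j≤i , j≢i) i-least = j≢i (antisym j≤i (i-least _))

  pairs-agree : ∀ {i x y a} → ¬ IsLeast i → ColourAt i x a → ColourAt i y a →
                c i x ≡ c i y × d i x ≡ d i y
  pairs-agree ¬least (_ , x-pair) (_ , y-pair) =
    pairHF-injective (trans (sym (x-pair ¬least)) (y-pair ¬least))

  ¬edge-with-one-new-vertex : ∀ {x y z i j} → InΓ G Γ (tri G x y z) →
    IsLeastIndex x i → A j y → A j z → j < i → ⊥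
  ¬edge-with-one-new-vertex {j = j} edge (_ , minimal) y∈ z∈ (j≤i , j≢i) =
    j≢i (antisym j≤i (minimal j (edge-closed (A-closed j) edge 0F others)))
    where
      others : ∀ s → s ≢ 0F → A j (tri G _ _ _ s)
      others 0F 0≢0 = ⊥-elim (0≢0 refl)
      others 1F _ = y∈
      others 2F _ = z∈

  ¬mono-edge-with-two-new-vertices : ∀ {x y z i k a} → InΓ G Γ (tri G x y z) →
    IsLeastIndex x i → IsLeastIndex y i → A k z → k < i →
    ColourAt i x a → ColourAt i y a → ⊥
  ¬mono-edge-with-two-new-vertices {x} {y} {z} {i} {k} edge x-least y-least z∈ k<i x-col y-col =
    d-col i ¬least x y x-new y-new
      (proj₂ x-new , proj₂ y-new , x≢y , z , (k , k<i , z∈) , edge)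
      (proj₂ (pairs-agree ¬least x-col y-col))
    where
      ¬least = <⇒¬IsLeast k<i
      x-new = leastIndex⇒New x-least
      y-new = leastIndex⇒New y-least
      x≢y = proj₁ (proj₂ edge) 0F 1F λ ()

  ¬mono-edge-within-one-stage : ∀ {x y z i a} → InΓ G Γ (tri G x y z) →
    A i x → A i y → A i z → ColourAt i x a → ColourAt i y a → ColourAt i z a → ⊥
  ¬mono-edge-within-one-stage {x} {y} {z} {i} edge x∈ y∈ z∈ x-col y-col z-col =
    ¬¬-excluded-middle λ where
      (yes least) → c-col i _ edge all∈
        (trans (sym (proj₁ x-col least)) (proj₁ y-col least) ,
         trans (sym (proj₁ y-col least)) (proj₁ z-col least))
      (no ¬least) → c-col i _ edge all∈
        (proj₁ (pairs-agree ¬least x-col y-col) , proj₁ (pairs-agree ¬least y-col z-col))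
    where
      all∈ : ∀ m → A i (tri G x y z m)
      all∈ 0F = x∈
      all∈ 1F = y∈
      all∈ 2F = z∈

  ¬mono-sorted-edge : ∀ {x y z i j k a} → InΓ G Γ (tri G x y z) →
    AmalgAt i x a → AmalgAt j y a → AmalgAt k z a → k ≤ j → j ≤ i → ⊥
  ¬mono-sorted-edge edge (x-least , x-col) ((y∈ , y-min) , y-col) ((z∈ , _) , z-col) k≤j j≤i =
    ¬¬-excluded-middle λ where
      (no j≢i) → ¬edge-with-one-new-vertex edge x-least y∈ (A-mono _ _ k≤j _ z∈) (j≤i , j≢i)
      (yes refl) → ¬¬-excluded-middle λ where
        (no k≢i) → ¬mono-edge-with-two-new-vertices edge x-least (y∈ , y-min) z∈ (k≤j , k≢i)
                     x-col y-col
        (yes refl) → ¬mono-edge-within-one-stage edge (proj₁ x-least) y∈ z∈ x-col y-col z-col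

proposition2p10 : (G : AbGroup) (Γ : Hyp G) (S : Coherent G Γ)
    (v : Triple G) → InΓ G Γ v → (w : Fin 3 → HF)
    → (∀ m → Coherent.Amalg S (v m) (w m)) → ¬ Mono G Γ w
proposition2p10 G Γ S v edge w am mono
  with sort₃ (IsTotalOrder.total (Coherent.isTotalOrder S)) (λ m → proj₁ (am m))
... | π , k≤j , j≤i =
  ¬mono-sorted-edge (InΓ-reindex π (λ { 0F → refl ; 1F → refl ; 2F → refl }) edge)
    (stage 0F) (stage 1F) (stage 2F) k≤j j≤i
  where
    open Hyperedges G Γ
    open Amalgamation G Γ S
    stage : ∀ m → AmalgAt (index (am (π ⟨$⟩ʳ m))) (v (π ⟨$⟩ʳ m)) (w 0F)
    stage m = subst (AmalgAt _ _) (Mono⇒≡w₀ {w} mono (π ⟨$⟩ʳ m))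
                    (amalgAt-index (am (π ⟨$⟩ʳ m)))
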